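{- The game $\overline{1}=\{\cdot\mid 0\}$ is prime in the monoid $\mathcal{L}$ of Left dead ends: for all Left dead ends $H,K$, if there is a Left dead end $G$ with $\overline{1}+G=H+K$, then there is a Left dead end $X$ with $H=\overline{1}+X$ or $K=\overline{1}+X$.
   Context: All games are short partizan combinatorial game forms; $G+H$ is the disjunctive sum; $0=\{\cdot\mid\cdot\}$. Play is misère (a player unable to move wins). Misère outcome classes are ordered $\mathscr L>\mathscr P>\mathscr R$ and $\mathscr L>\mathscr N>\mathscr R$; $G\geq H$ means that for every game $X$ the misère outcome of $G+X$ is $\geq$ that of $H+X$, and $G=H$ means $G\ge H$ and $H\ge G$. A Left dead end is a game no subposition of which (including itself) has a Left option. The Left dead ends, up to equality, form a commutative monoid $\mathcal{L}$ under $+$. -}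

module Defs where

open import Data.Nat using (ℕ; zero; suc; _+_)
open import Data.Fin using (Fin; splitAt)
open import Data.Sum using (_⊎_; inj₁; inj₂; [_,_])
open import Data.Product using (Σ; _×_; _,_)
open import Data.Bool using (Bool; true; false; not; _∨_)
open import Relation.Binary.PropositionalEquality using (_≡_)

data Game : Set where
  mk : (nL : ℕ) → (Fin nL → Game) → (nR : ℕ) → (Fin nR → Game) → Game

nLeft : Game → ℕ
nLeft (mk nL _ _ _) = nL

noOpt : {A : Set} → Fin 0 → A
noOpt ()

zeroG : Game
zeroG = mk 0 noOpt 0 noOpt

oneBar : Game
oneBar = mk 0 noOpt 1 (λ _ → zeroG)

infixl 6 _⊕_
_⊕_ : Game → Game → Game
G@(mk a L b R) ⊕ H@(mk c L' d R') =
  mk (a + c) (λ i → [ (λ i₁ → L i₁ ⊕ H) , (λ i₂ → G ⊕ L' i₂) ] (splitAt a i))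
     (b + d) (λ j → [ (λ j₁ → R j₁ ⊕ H) , (λ j₂ → G ⊕ R' j₂) ] (splitAt b j))

anyFin : (n : ℕ) → (Fin n → Bool) → Bool
anyFin zero    f = false
anyFin (suc n) f = f Fin.zero ∨ anyFin n (λ i → f (Fin.suc i))
  where import Data.Fin as Fin

-- Misère play: a player unable to move (on their turn) wins.
-- leftWins G : Left, moving first in G, has a winning strategy.
-- rightWins G : Right, moving first in G, has a winning strategy.
leftWins  : Game → Bool
rightWins : Game → Bool
leftWins (mk zero    L nR R) = true
leftWins (mk (suc n) L nR R) = anyFin (suc n) (λ i → not (rightWins (L i)))
rightWins (mk nL L zero    R) = true
rightWins (mk nL L (suc n) R) = anyFin (suc n) (λ j → not (leftWins (R j)))

data Outcome : Set where
  𝓛 𝓝 𝓟 𝓡 : Outcome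

outcomeOf : Bool → Bool → Outcome
outcomeOf true  false = 𝓛
outcomeOf true  true  = 𝓝
outcomeOf false false = 𝓟
outcomeOf false true  = 𝓡

outcome : Game → Outcome
outcome G = outcomeOf (leftWins G) (rightWins G)

data _≤ₒ_ : Outcome → Outcome → Set where
  refl≤ : ∀ {o} → o ≤ₒ o
  𝓡≤𝓟 : 𝓡 ≤ₒ 𝓟
  𝓡≤𝓝 : 𝓡 ≤ₒ 𝓝
  𝓡≤𝓛 : 𝓡 ≤ₒ 𝓛
  𝓟≤𝓛 : 𝓟 ≤ₒ 𝓛
  𝓝≤𝓛 : 𝓝 ≤ₒ 𝓛

_≥G_ : Game → Game → Set
G ≥G H = (X : Game) → outcome (H ⊕ X) ≤ₒ outcome (G ⊕ X)

_≡G_ : Game → Game → Set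
G ≡G H = (G ≥G H) × (H ≥G G)

data _≼_ : Game → Game → Set where
  here  : ∀ {G} → G ≼ G
  viaL  : ∀ {S nL L nR R} (i : Fin nL) → S ≼ L i → S ≼ mk nL L nR R
  viaR  : ∀ {S nL L nR R} (j : Fin nR) → S ≼ R j → S ≼ mk nL L nR R

LeftDeadEnd : Game → Set
LeftDeadEnd G = (S : Game) → S ≼ G → nLeft S ≡ 0

{-# OPTIONS --safe #-}
module Submission where

-- On Left dead ends the misère order is structural: G ≥ H iff H has no Right
-- option whenever G has none, and every G^R dominates some H^R (this is _≽_).
-- One direction is an induction on strategies; for the other, a failure of
-- the condition is witnessed by a game X that Right, moving first, wins in
-- G + X but not in H + X.  In this order 1̄ + G has a least Right option,
-- 0 + G = G, so if 1̄ + G = H + K then H + K has a least Right option, say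
-- H^r + K.  Cancelling K, which holds because the length of Right's shortest
-- run to a position without Right options is additive and monotone, makes H^r
-- the least Right option of H, and a dead end with least Right option Y^r
-- equals 1̄ + Y^r.

open import Data.Bool using (Bool; true; false; not; T)
open import Data.Bool.Properties using (T-∨)
open import Data.Empty using (⊥-elim)
open import Data.Fin using (Fin; splitAt; _↑ˡ_; _↑ʳ_)
import Data.Fin as Fin
open import Data.Fin.Properties using (¬Fin0; splitAt-↑ˡ; splitAt-↑ʳ; all?; any?; ¬∀⟶∃¬)
open import Data.Nat using (ℕ; zero; suc; _+_; _≤_; _⊓_; s≤s)
open import Data.Nat.Properties
  using (_≟_; +-comm; +-suc; ≤-refl; ≤-reflexive; ≤-trans; +-monoˡ-≤; +-monoʳ-≤; +-cancelʳ-≤;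
         n≤0⇒n≡0; m+n≡0⇒m≡0; m+n≡0⇒n≡0; m⊓n≤m; m⊓n≤n; ⊓-sel; module ≤-Reasoning)
open import Data.Product using (Σ; ∃; _×_; _,_; proj₁; proj₂)
import Data.Product as Product
open import Data.Sum using (_⊎_; inj₁; inj₂; [_,_]′)
import Data.Sum as Sum
open import Data.Unit using (tt)
open import Data.Vec.Functional using (_∷_)
open import Function using (_∘_; case_of_)
open import Function.Bundles using (_⇔_; mk⇔; Equivalence)
open import Relation.Binary.PropositionalEquality
open import Relation.Nullary using (¬_; Dec)
open import Relation.Nullary.Decidable using (map′; _×-dec_; _→-dec_; decidable-stable)

open import Defs

open Equivalence using (to; from)

nRight : Game → ℕ
nRight (mk _ _ nR _) = nR

leftOpt : (G : Game) → Fin (nLeft G) → Game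
leftOpt (mk _ L _ _) = L

rightOpt : (G : Game) → Fin (nRight G) → Game
rightOpt (mk _ _ _ R) = R

NoLeft NoRight : Game → Set
NoLeft G = nLeft G ≡ 0
NoRight G = nRight G ≡ 0

nLeft-⊕ : ∀ A B → nLeft (A ⊕ B) ≡ nLeft A + nLeft B
nLeft-⊕ (mk _ _ _ _) (mk _ _ _ _) = refl

nRight-⊕ : ∀ A B → nRight (A ⊕ B) ≡ nRight A + nRight B
nRight-⊕ (mk _ _ _ _) (mk _ _ _ _) = refl

leftOpt-⊕ : ∀ A B k → (∃ λ s → leftOpt (A ⊕ B) k ≡ leftOpt A s ⊕ B)
                    ⊎ (∃ λ t → leftOpt (A ⊕ B) k ≡ A ⊕ leftOpt B t)
leftOpt-⊕ (mk a _ _ _) (mk _ _ _ _) k with splitAt a k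
... | inj₁ s = inj₁ (s , refl)
... | inj₂ t = inj₂ (t , refl)

rightOpt-⊕ : ∀ A B k → (∃ λ s → rightOpt (A ⊕ B) k ≡ rightOpt A s ⊕ B)
                     ⊎ (∃ λ t → rightOpt (A ⊕ B) k ≡ A ⊕ rightOpt B t)
rightOpt-⊕ (mk _ _ b _) (mk _ _ _ _) k with splitAt b k
... | inj₁ s = inj₁ (s , refl)
... | inj₂ t = inj₂ (t , refl)

leftOpt-⊕ʳ : ∀ A B t → ∃ λ k → leftOpt (A ⊕ B) k ≡ A ⊕ leftOpt B t
leftOpt-⊕ʳ A@(mk a L _ _) B@(mk c L′ _ _) t =
  a ↑ʳ t , cong [ (λ s → L s ⊕ B) , (λ t → A ⊕ L′ t) ]′ (splitAt-↑ʳ a c t)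

rightOpt-⊕ˡ : ∀ A B s → ∃ λ k → rightOpt (A ⊕ B) k ≡ rightOpt A s ⊕ B
rightOpt-⊕ˡ A@(mk _ _ b R) B@(mk _ _ d R′) s =
  s ↑ˡ d , cong [ (λ s → R s ⊕ B) , (λ t → A ⊕ R′ t) ]′ (splitAt-↑ˡ b s d)

rightOpt-⊕ʳ : ∀ A B t → ∃ λ k → rightOpt (A ⊕ B) k ≡ A ⊕ rightOpt B t
rightOpt-⊕ʳ A@(mk _ _ b R) B@(mk _ _ d R′) t =
  b ↑ʳ t , cong [ (λ s → R s ⊕ B) , (λ t → A ⊕ R′ t) ]′ (splitAt-↑ʳ b d t)

LeftWins RightWins : Game → Set
LeftWins G = T (leftWins G)
RightWins G = T (rightWins G)

T-not : ∀ {b} → T (not b) ⇔ (¬ T b)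
T-not {true}  = mk⇔ (λ ()) (λ ¬t → ¬t tt)
T-not {false} = mk⇔ (λ _ ()) (λ _ → tt)

T-anyFin : ∀ n (f : Fin n → Bool) → T (anyFin n f) ⇔ (∃ λ i → T (f i))
T-anyFin zero    f = mk⇔ (λ ()) (λ ())
T-anyFin (suc n) f = mk⇔ to′ from′
  where
  to′ : T (anyFin (suc n) f) → ∃ λ i → T (f i)
  to′ p with to T-∨ p
  ... | inj₁ p₀ = Fin.zero , p₀
  ... | inj₂ p₊ = let i , pᵢ = to (T-anyFin n (f ∘ Fin.suc)) p₊ in Fin.suc i , pᵢ
  from′ : (∃ λ i → T (f i)) → T (anyFin (suc n) f)
  from′ (Fin.zero  , p) = from T-∨ (inj₁ p)
  from′ (Fin.suc i , p) = from T-∨ (inj₂ (from (T-anyFin n (f ∘ Fin.suc)) (i , p)))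

T-anyFin-not : ∀ n (f : Fin n → Bool) → T (anyFin n (not ∘ f)) ⇔ (∃ λ i → ¬ T (f i))
T-anyFin-not n f = mk⇔
  (λ p → let i , q = to (T-anyFin n (not ∘ f)) p in i , to T-not q)
  (λ (i , q) → from (T-anyFin n (not ∘ f)) (i , from T-not q))

leftWins⇔ : ∀ G → LeftWins G ⇔ (NoLeft G ⊎ ∃ λ i → ¬ RightWins (leftOpt G i))
leftWins⇔ (mk zero    L _ _) = mk⇔ (λ _ → inj₁ refl) (λ _ → tt)
leftWins⇔ (mk (suc n) L _ _) = mk⇔
  (inj₂ ∘ to (T-anyFin-not (suc n) (rightWins ∘ L)))
  [ (λ ()) , from (T-anyFin-not (suc n) (rightWins ∘ L)) ]′

rightWins⇔ : ∀ G → RightWins G ⇔ (NoRight G ⊎ ∃ λ j → ¬ LeftWins (rightOpt G j))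
rightWins⇔ (mk _ _ zero    _) = mk⇔ (λ _ → inj₁ refl) (λ _ → tt)
rightWins⇔ (mk _ _ (suc n) R) = mk⇔
  (inj₂ ∘ to (T-anyFin-not (suc n) (leftWins ∘ R)))
  [ (λ ()) , from (T-anyFin-not (suc n) (leftWins ∘ R)) ]′

outcomeOf-mono : ∀ {l₁ r₁ l₂ r₂} → (T l₁ → T l₂) → (T r₂ → T r₁) →
                 outcomeOf l₁ r₁ ≤ₒ outcomeOf l₂ r₂
outcomeOf-mono {true}  {_}     {false} {_}     l₁⇒l₂ _ = ⊥-elim (l₁⇒l₂ tt)
outcomeOf-mono {_}     {false} {_}     {true}  _ r₂⇒r₁ = ⊥-elim (r₂⇒r₁ tt)
outcomeOf-mono {false} {false} {false} {false} _ _ = refl≤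
outcomeOf-mono {false} {true}  {false} {false} _ _ = 𝓡≤𝓟
outcomeOf-mono {false} {true}  {false} {true}  _ _ = refl≤
outcomeOf-mono {false} {false} {true}  {false} _ _ = 𝓟≤𝓛
outcomeOf-mono {false} {true}  {true}  {false} _ _ = 𝓡≤𝓛
outcomeOf-mono {false} {true}  {true}  {true}  _ _ = 𝓡≤𝓝
outcomeOf-mono {true}  {false} {true}  {false} _ _ = refl≤
outcomeOf-mono {true}  {true}  {true}  {false} _ _ = 𝓝≤𝓛
outcomeOf-mono {true}  {true}  {true}  {true}  _ _ = refl≤

≤ₒ-rightWins : ∀ {l₁ r₁ l₂ r₂} → outcomeOf l₁ r₁ ≤ₒ outcomeOf l₂ r₂ → T r₂ → T r₁
≤ₒ-rightWins {r₁ = true} _ _ = tt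
≤ₒ-rightWins {false} {false} {false} {true} () _
≤ₒ-rightWins {false} {false} {true}  {true} () _
≤ₒ-rightWins {true}  {false} {false} {true} () _
≤ₒ-rightWins {true}  {false} {true}  {true} () _

data DeadEnd : Game → Set where
  deadEnd : ∀ {L b R} → (∀ j → DeadEnd (R j)) → DeadEnd (mk 0 L b R)

DeadEnd-rightOpt : ∀ {D} → DeadEnd D → ∀ j → DeadEnd (rightOpt D j)
DeadEnd-rightOpt (deadEnd dR) = dR

LeftDeadEnd⇒DeadEnd : ∀ G → LeftDeadEnd G → DeadEnd G
LeftDeadEnd⇒DeadEnd (mk _ _ _ R) ld with ld _ here
... | refl = deadEnd λ j → LeftDeadEnd⇒DeadEnd (R j) λ S S≼Rj → ld S (viaR j S≼Rj)

DeadEnd⇒LeftDeadEnd : ∀ {G} → DeadEnd G → LeftDeadEnd G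
DeadEnd⇒LeftDeadEnd (deadEnd _)  _ here           = refl
DeadEnd⇒LeftDeadEnd (deadEnd dR) S (viaR j S≼Rj) = DeadEnd⇒LeftDeadEnd (dR j) S S≼Rj

DeadEnd-⊕ : ∀ {A B} → DeadEnd A → DeadEnd B → DeadEnd (A ⊕ B)
DeadEnd-⊕ {A} {B} dA@(deadEnd dR) dB@(deadEnd dR′) = deadEnd λ k → [
    (λ (s , eq) → subst DeadEnd (sym eq) (DeadEnd-⊕ (dR s) dB)) ,
    (λ (t , eq) → subst DeadEnd (sym eq) (DeadEnd-⊕ dA (dR′ t))) ]′ (rightOpt-⊕ A B k)

oneBar-DeadEnd : DeadEnd oneBar
oneBar-DeadEnd = deadEnd λ _ → deadEnd λ ()

leftWins-DeadEnd⊕ : ∀ {D} X → DeadEnd D →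
  LeftWins (D ⊕ X) ⇔ (NoLeft X ⊎ ∃ λ i → ¬ RightWins (D ⊕ leftOpt X i))
leftWins-DeadEnd⊕ {D} X (deadEnd _) = mk⇔
  (λ p → case to (leftWins⇔ (D ⊕ X)) p of λ where
    (inj₁ noLeft)   → inj₁ (trans (sym (nLeft-⊕ D X)) noLeft)
    (inj₂ (k , ¬w)) → case leftOpt-⊕ D X k of λ where
      (inj₁ (() , _))
      (inj₂ (i , eq)) → inj₂ (i , ¬w ∘ subst RightWins (sym eq)))
  λ where
    (inj₁ noLeft)   → from (leftWins⇔ (D ⊕ X)) (inj₁ (trans (nLeft-⊕ D X) noLeft))
    (inj₂ (i , ¬w)) → let k , eq = leftOpt-⊕ʳ D X i in
      from (leftWins⇔ (D ⊕ X)) (inj₂ (k , ¬w ∘ subst RightWins eq))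

rightWins-⊕ : ∀ A B → RightWins (A ⊕ B) ⇔
  (NoRight A × NoRight B ⊎ (∃ λ s → ¬ LeftWins (rightOpt A s ⊕ B))
                         ⊎ (∃ λ t → ¬ LeftWins (A ⊕ rightOpt B t)))
rightWins-⊕ A B = mk⇔
  (λ p → case to (rightWins⇔ (A ⊕ B)) p of λ where
    (inj₁ noRight)  → let n≡0 = trans (sym (nRight-⊕ A B)) noRight in
      inj₁ (m+n≡0⇒m≡0 (nRight A) n≡0 , m+n≡0⇒n≡0 (nRight A) n≡0)
    (inj₂ (k , ¬w)) → case rightOpt-⊕ A B k of λ where
      (inj₁ (s , eq)) → inj₂ (inj₁ (s , ¬w ∘ subst LeftWins (sym eq)))
      (inj₂ (t , eq)) → inj₂ (inj₂ (t , ¬w ∘ subst LeftWins (sym eq))))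
  λ where
    (inj₁ (noA , noB)) →
      from (rightWins⇔ (A ⊕ B)) (inj₁ (trans (nRight-⊕ A B) (cong₂ _+_ noA noB)))
    (inj₂ (inj₁ (s , ¬w))) → let k , eq = rightOpt-⊕ˡ A B s in
      from (rightWins⇔ (A ⊕ B)) (inj₂ (k , ¬w ∘ subst LeftWins eq))
    (inj₂ (inj₂ (t , ¬w))) → let k , eq = rightOpt-⊕ʳ A B t in
      from (rightWins⇔ (A ⊕ B)) (inj₂ (k , ¬w ∘ subst LeftWins eq))

infix 4 _≽_ _≽R_ _≋_

record _≽_ (G H : Game) : Set
_≽R_ : Game → Game → Set

record _≽_ G H where
  inductive
  constructor ≽-intro
  field
    noRight-≽  : NoRight G → NoRight H
    rightOpt-≽ : ∀ j → rightOpt G j ≽R H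
open _≽_

X ≽R H = ∃ λ k → X ≽ rightOpt H k

_≋_ : Game → Game → Set
A ≋ B = A ≽ B × B ≽ A

≽-trans : ∀ {A B C} → A ≽ B → B ≽ C → A ≽ C
≽-trans {mk _ _ _ R} A≽B B≽C = ≽-intro (noRight-≽ B≽C ∘ noRight-≽ A≽B) λ j →
  let k , Rj≽Bk = rightOpt-≽ A≽B j
      l , Bk≽Cl = rightOpt-≽ B≽C k
  in l , ≽-trans {R j} Rj≽Bk Bk≽Cl

≽-dec : ∀ A B → Dec (A ≽ B)
≽-dec (mk _ _ b R) B = map′ (λ (e , f) → ≽-intro e f) (λ A≽B → noRight-≽ A≽B , rightOpt-≽ A≽B)
  ((b ≟ 0 →-dec nRight B ≟ 0) ×-dec all? λ j → any? λ k → ≽-dec (R j) (rightOpt B k))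

≽R-⊕ˡ : ∀ {X} A B s → X ≽ rightOpt A s ⊕ B → X ≽R A ⊕ B
≽R-⊕ˡ {X} A B s X≽ = let k , eq = rightOpt-⊕ˡ A B s in k , subst (X ≽_) (sym eq) X≽

≽R-⊕ʳ : ∀ {X} A B t → X ≽ A ⊕ rightOpt B t → X ≽R A ⊕ B
≽R-⊕ʳ {X} A B t X≽ = let k , eq = rightOpt-⊕ʳ A B t in k , subst (X ≽_) (sym eq) X≽

rightOpt-≽-⊕ˡ : ∀ {Y} A B → A ⊕ B ≽ Y → ∀ s → rightOpt A s ⊕ B ≽R Y
rightOpt-≽-⊕ˡ {Y} A B A⊕B≽Y s =
  let k , eq = rightOpt-⊕ˡ A B s in subst (_≽R Y) eq (rightOpt-≽ A⊕B≽Y k)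

rightOpt-≽-⊕ʳ : ∀ {Y} A B → A ⊕ B ≽ Y → ∀ t → A ⊕ rightOpt B t ≽R Y
rightOpt-≽-⊕ʳ {Y} A B A⊕B≽Y t =
  let k , eq = rightOpt-⊕ʳ A B t in subst (_≽R Y) eq (rightOpt-≽ A⊕B≽Y k)

⊕-identityˡ : ∀ {E} → NoRight E → ∀ Y → E ⊕ Y ≋ Y
⊕-identityˡ {E} noE Y@(mk _ _ _ R) = E⊕Y≽Y , Y≽E⊕Y
  where
  E⊕Y≽Y : E ⊕ Y ≽ Y
  E⊕Y≽Y = ≽-intro (m+n≡0⇒n≡0 (nRight E) ∘ trans (sym (nRight-⊕ E Y))) λ k → [
      (λ (s , _)  → ⊥-elim (¬Fin0 (subst Fin noE s))) ,
      (λ (t , eq) → t , subst (_≽ R t) (sym eq) (proj₁ (⊕-identityˡ noE (R t)))) ]′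
    (rightOpt-⊕ E Y k)
  Y≽E⊕Y : Y ≽ E ⊕ Y
  Y≽E⊕Y = ≽-intro (trans (nRight-⊕ E Y) ∘ cong₂ _+_ noE) λ t →
    ≽R-⊕ʳ E Y t (proj₂ (⊕-identityˡ noE (R t)))

⊕-comm-≽ : ∀ A B → A ⊕ B ≽ B ⊕ A
⊕-comm-≽ A@(mk _ _ b R) B@(mk _ _ d R′) = ≽-intro (trans (+-comm d b)) λ k → [
    (λ (s , eq) → ≽R-⊕ʳ B A s (subst (_≽ B ⊕ R s) (sym eq) (⊕-comm-≽ (R s) B))) ,
    (λ (t , eq) → ≽R-⊕ˡ B A t (subst (_≽ R′ t ⊕ A) (sym eq) (⊕-comm-≽ A (R′ t)))) ]′
  (rightOpt-⊕ A B k)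

oneBar⊕-¬NoRight : ∀ X → ¬ NoRight (oneBar ⊕ X)
oneBar⊕-¬NoRight (mk _ _ _ _) ()

rightOpt-oneBar⊕-≽ : ∀ X p → rightOpt (oneBar ⊕ X) p ≽ X
oneBar⊕rightOpt-≽ : ∀ Y r → oneBar ⊕ rightOpt Y r ≽ Y

rightOpt-oneBar⊕-≽ X p = [
    (λ (_ , eq) → subst (_≽ X) (sym eq) (proj₁ (⊕-identityˡ refl X))) ,
    (λ (t , eq) → subst (_≽ X) (sym eq) (oneBar⊕rightOpt-≽ X t)) ]′
  (rightOpt-⊕ oneBar X p)

oneBar⊕rightOpt-≽ (mk _ _ _ R) r = ≽-intro (⊥-elim ∘ oneBar⊕-¬NoRight (R r)) λ p →
  r , rightOpt-oneBar⊕-≽ (R r) p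

oneBar⊕-≽⇒≽R : ∀ {G Y} → oneBar ⊕ G ≽ Y → G ≽R Y
oneBar⊕-≽⇒≽R {G} oneBar⊕G≽Y =
  let m , zeroG⊕G≽Yₘ = rightOpt-≽-⊕ˡ oneBar G oneBar⊕G≽Y Fin.zero
  in m , ≽-trans (proj₂ (⊕-identityˡ refl G)) zeroG⊕G≽Yₘ

≽⇒≽R-oneBar⊕ : ∀ {Z X} → Z ≽ X → Z ≽R oneBar ⊕ X
≽⇒≽R-oneBar⊕ {X = X} Z≽X =
  ≽R-⊕ˡ oneBar X Fin.zero (≽-trans Z≽X (proj₂ (⊕-identityˡ refl X)))

minimum : ∀ n → (Fin (suc n) → ℕ) → ℕ
minimum zero    f = f Fin.zero
minimum (suc n) f = f Fin.zero ⊓ minimum n (f ∘ Fin.suc)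

minimum-≤ : ∀ n f i → minimum n f ≤ f i
minimum-≤ zero    f Fin.zero    = ≤-refl
minimum-≤ (suc n) f Fin.zero    = m⊓n≤m (f Fin.zero) _
minimum-≤ (suc n) f (Fin.suc i) = ≤-trans (m⊓n≤n (f Fin.zero) _) (minimum-≤ n (f ∘ Fin.suc) i)

minimum-attained : ∀ n f → ∃ λ i → minimum n f ≡ f i
minimum-attained zero    f = Fin.zero , refl
minimum-attained (suc n) f with ⊓-sel (f Fin.zero) (minimum n (f ∘ Fin.suc))
... | inj₁ eq = Fin.zero , eq
... | inj₂ eq = let i , eq′ = minimum-attained n (f ∘ Fin.suc) in Fin.suc i , trans eq eq′

shortestRightRun : Game → ℕ
shortestRightRun (mk _ _ zero    _) = 0
shortestRightRun (mk _ _ (suc n) R) = suc (minimum n (shortestRightRun ∘ R))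

shortestRightRun-≤ : ∀ G j → shortestRightRun G ≤ suc (shortestRightRun (rightOpt G j))
shortestRightRun-≤ (mk _ _ (suc n) R) j = s≤s (minimum-≤ n (shortestRightRun ∘ R) j)

shortestRightRun-attained : ∀ G → NoRight G ⊎
  ∃ λ j → shortestRightRun G ≡ suc (shortestRightRun (rightOpt G j))
shortestRightRun-attained (mk _ _ zero    _) = inj₁ refl
shortestRightRun-attained (mk _ _ (suc n) R) =
  let j , eq = minimum-attained n (shortestRightRun ∘ R) in inj₂ (j , cong suc eq)

NoRight⇒shortestRightRun≡0 : ∀ G → NoRight G → shortestRightRun G ≡ 0
NoRight⇒shortestRightRun≡0 (mk _ _ zero _) _ = refl

shortestRightRun≡0⇒NoRight : ∀ G → shortestRightRun G ≡ 0 → NoRight G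
shortestRightRun≡0⇒NoRight (mk _ _ zero _) _ = refl

shortestRightRun-mono : ∀ {Y X} → Y ≽ X → shortestRightRun X ≤ shortestRightRun Y
shortestRightRun-mono {Y@(mk _ _ _ R)} {X} Y≽X with shortestRightRun-attained Y
... | inj₁ noY = ≤-reflexive (trans (NoRight⇒shortestRightRun≡0 X (noRight-≽ Y≽X noY))
                                   (sym (NoRight⇒shortestRightRun≡0 Y noY)))
... | inj₂ (j , eq) = let k , Rj≽Xk = rightOpt-≽ Y≽X j in begin
  shortestRightRun X                  ≤⟨ shortestRightRun-≤ X k ⟩
  suc (shortestRightRun (rightOpt X k)) ≤⟨ s≤s (shortestRightRun-mono {R j} Rj≽Xk) ⟩
  suc (shortestRightRun (R j))        ≡⟨ sym eq ⟩
  shortestRightRun Y                  ∎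
  where open ≤-Reasoning

shortestRightRun-⊕ : ∀ A B → shortestRightRun A + shortestRightRun B ≤ shortestRightRun (A ⊕ B)
shortestRightRun-⊕-rightOpt : ∀ A B k →
  shortestRightRun A + shortestRightRun B ≤ suc (shortestRightRun (rightOpt (A ⊕ B) k))

shortestRightRun-⊕ A B = case shortestRightRun-attained (A ⊕ B) of λ where
  (inj₁ noA⊕B) → let n≡0 = trans (sym (nRight-⊕ A B)) noA⊕B in ≤-reflexive (trans
    (cong₂ _+_ (NoRight⇒shortestRightRun≡0 A (m+n≡0⇒m≡0 (nRight A) n≡0))
               (NoRight⇒shortestRightRun≡0 B (m+n≡0⇒n≡0 (nRight A) n≡0)))
    (sym (NoRight⇒shortestRightRun≡0 (A ⊕ B) noA⊕B)))
  (inj₂ (k , eq)) → subst (shortestRightRun A + shortestRightRun B ≤_) (sym eq)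
                           (shortestRightRun-⊕-rightOpt A B k)

shortestRightRun-⊕-rightOpt A@(mk _ _ _ R) B@(mk _ _ _ R′) k = [
    (λ (s , eq) → begin
      shortestRightRun A + shortestRightRun B            ≤⟨ +-monoˡ-≤ _ (shortestRightRun-≤ A s) ⟩
      suc (shortestRightRun (R s) + shortestRightRun B)  ≤⟨ s≤s (shortestRightRun-⊕ (R s) B) ⟩
      suc (shortestRightRun (R s ⊕ B))                   ≡⟨ cong (suc ∘ shortestRightRun) eq ⟨
      suc (shortestRightRun (rightOpt (A ⊕ B) k))        ∎) ,
    (λ (t , eq) → begin
      shortestRightRun A + shortestRightRun B            ≤⟨ +-monoʳ-≤ _ (shortestRightRun-≤ B t) ⟩
      shortestRightRun A + suc (shortestRightRun (R′ t)) ≡⟨ +-suc _ _ ⟩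
      suc (shortestRightRun A + shortestRightRun (R′ t)) ≤⟨ s≤s (shortestRightRun-⊕ A (R′ t)) ⟩
      suc (shortestRightRun (A ⊕ R′ t))                  ≡⟨ cong (suc ∘ shortestRightRun) eq ⟨
      suc (shortestRightRun (rightOpt (A ⊕ B) k))        ∎) ]′
  (rightOpt-⊕ A B k)
  where open ≤-Reasoning

≽-⊕⇒NoRight : ∀ {A K} → K ≽ A ⊕ K → NoRight A
≽-⊕⇒NoRight {A} {K} K≽A⊕K = shortestRightRun≡0⇒NoRight A (n≤0⇒n≡0 (+-cancelʳ-≤ _ _ 0 (begin
  shortestRightRun A + shortestRightRun K ≤⟨ shortestRightRun-⊕ A K ⟩
  shortestRightRun (A ⊕ K)                ≤⟨ shortestRightRun-mono K≽A⊕K ⟩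
  shortestRightRun K                      ∎)))
  where open ≤-Reasoning

≽-cancelʳ : ∀ {B A} K → B ⊕ K ≽ A ⊕ K → B ≽ A
≽R-cancelʳ : ∀ {X} A K → X ⊕ K ≽R A ⊕ K → X ≽R A

≽-cancelʳ {B@(mk _ _ _ _)} {A} K B⊕K≽A⊕K = ≽-intro
  (λ noB → ≽-⊕⇒NoRight (≽-trans (proj₂ (⊕-identityˡ noB K)) B⊕K≽A⊕K))
  (λ j → ≽R-cancelʳ A K (rightOpt-≽-⊕ˡ B K B⊕K≽A⊕K j))

≽R-cancelʳ {X} A K@(mk _ _ _ R′) (k , X⊕K≽) = [
    (λ (s , eq) → s , ≽-cancelʳ K (subst (X ⊕ K ≽_) eq X⊕K≽)) ,
    (λ (t , eq) → ≽R-cancelʳ A (R′ t) (rightOpt-≽-⊕ʳ X K (subst (X ⊕ K ≽_) eq X⊕K≽) t)) ]′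
  (rightOpt-⊕ A K k)

≽-cancelˡ : ∀ {B A} K → K ⊕ B ≽ K ⊕ A → B ≽ A
≽-cancelˡ {B} {A} K K⊕B≽K⊕A =
  ≽-cancelʳ K (≽-trans (⊕-comm-≽ B K) (≽-trans K⊕B≽K⊕A (⊕-comm-≽ K A)))

≽⇒leftWins : ∀ {A B} X → DeadEnd A → DeadEnd B → A ≽ B → LeftWins (B ⊕ X) → LeftWins (A ⊕ X)
≽⇒rightWins : ∀ {A B} X → DeadEnd A → DeadEnd B → A ≽ B → RightWins (A ⊕ X) → RightWins (B ⊕ X)

≽⇒leftWins X@(mk _ L _ _) dA dB A≽B w = from (leftWins-DeadEnd⊕ X dA)
  (Sum.map₂ (λ (i , ¬w) → i , ¬w ∘ ≽⇒rightWins (L i) dA dB A≽B)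
    (to (leftWins-DeadEnd⊕ X dB) w))

≽⇒rightWins {A} {B} X@(mk _ _ _ R) dA@(deadEnd dR) dB A≽B w = from (rightWins-⊕ B X)
  (Sum.map (Product.map₁ (noRight-≽ A≽B)) (Sum.map
    (λ (s , ¬w) → let k , Rs≽Bk = rightOpt-≽ A≽B s in
      k , ¬w ∘ ≽⇒leftWins X (dR s) (DeadEnd-rightOpt dB k) Rs≽Bk)
    (λ (t , ¬w) → t , ¬w ∘ ≽⇒leftWins (R t) dA dB A≽B))
    (to (rightWins-⊕ A X) w))

≽⇒≥G : ∀ {A B} → DeadEnd A → DeadEnd B → A ≽ B → A ≥G B
≽⇒≥G dA dB A≽B X = outcomeOf-mono (≽⇒leftWins X dA dB A≽B) (≽⇒rightWins X dA dB A≽B)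

-- Right, moving first in D ⊕ leftCounter D, follows the first Right options of D while Left can
-- only answer along the counter; Right is the first to run out of moves, and so wins.
leftCounter : Game → Game
leftCounter (mk _ _ zero    _) = zeroG
leftCounter (mk _ _ (suc _) R) = mk 1 (λ _ → leftCounter (R Fin.zero)) 0 noOpt

rightWins-⊕leftCounter : ∀ {D} → DeadEnd D → RightWins (D ⊕ leftCounter D)
rightWins-⊕leftCounter {mk _ _ zero    _} (deadEnd _)  = tt
rightWins-⊕leftCounter {D@(mk _ _ (suc _) R)} (deadEnd dR) =
  from (rightWins-⊕ D (leftCounter D)) (inj₂ (inj₁ (Fin.zero , λ w →
    case to (leftWins-DeadEnd⊕ (leftCounter D) (dR Fin.zero)) w of λ where
      (inj₁ ())
      (inj₂ (Fin.zero , ¬w)) → ¬w (rightWins-⊕leftCounter (dR Fin.zero)))))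

¬≽⇒separatingGame : ∀ {A B} → DeadEnd A → DeadEnd B → ¬ A ≽ B →
  ∃ λ X → RightWins (A ⊕ X) × ¬ RightWins (B ⊕ X)
¬≽⇒separatingGame {mk _ _ zero _} {mk _ _ zero _} _ _ A⋡B =
  ⊥-elim (A⋡B (≽-intro (λ _ → refl) λ ()))
¬≽⇒separatingGame {mk _ _ zero _} {B@(mk _ _ (suc _) _)} _ (deadEnd dR′) _ = zeroG , tt , λ w →
  case to (rightWins-⊕ B zeroG) w of λ where
    (inj₁ (() , _))
    (inj₂ (inj₁ (k , ¬w))) → ¬w (from (leftWins-DeadEnd⊕ zeroG (dR′ k)) (inj₁ refl))
    (inj₂ (inj₂ (() , _)))
¬≽⇒separatingGame {A@(mk _ _ (suc a) R)} {B@(mk _ _ b R′)} (deadEnd dR) (deadEnd dR′) A⋡B =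
  X , A⊕X-rightWins , B⊕X-¬rightWins
  where
  unmatched : ∃ λ j → ¬ ∃ λ k → R j ≽ R′ k
  unmatched = ¬∀⟶∃¬ (suc a) _ (λ j → any? λ k → ≽-dec (R j) (R′ k)) (A⋡B ∘ ≽-intro λ ())
  j = proj₁ unmatched
  sep : ∀ k → ∃ λ Xₖ → RightWins (R j ⊕ Xₖ) × ¬ RightWins (R′ k ⊕ Xₖ)
  sep k = ¬≽⇒separatingGame (dR j) (dR′ k) λ Rj≽R′k → proj₂ unmatched (k , Rj≽R′k)
  -- Every Left option of X loses against R j, so Right wins A ⊕ X by moving to R j ⊕ X.  In
  -- B ⊕ X, Left answers R′ k with the separating game of R j and R′ k, and Right's move in X
  -- leaves B ⊕ 0, where Left cannot move.
  X : Game
  X = mk (suc b) (leftCounter (R j) ∷ proj₁ ∘ sep) 1 λ _ → zeroG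
  A⊕X-rightWins : RightWins (A ⊕ X)
  A⊕X-rightWins = from (rightWins-⊕ A X) (inj₂ (inj₁ (j , λ w →
    case to (leftWins-DeadEnd⊕ X (dR j)) w of λ where
      (inj₁ ())
      (inj₂ (Fin.zero , ¬w))  → ¬w (rightWins-⊕leftCounter (dR j))
      (inj₂ (Fin.suc k , ¬w)) → ¬w (proj₁ (proj₂ (sep k))))))
  B⊕X-¬rightWins : ¬ RightWins (B ⊕ X)
  B⊕X-¬rightWins w = case to (rightWins-⊕ B X) w of λ where
    (inj₁ (_ , ()))
    (inj₂ (inj₁ (k , ¬w))) →
      ¬w (from (leftWins-DeadEnd⊕ X (dR′ k)) (inj₂ (Fin.suc k , proj₂ (proj₂ (sep k)))))
    (inj₂ (inj₂ (_ , ¬w))) → ¬w tt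

≥G⇒≽ : ∀ {A B} → DeadEnd A → DeadEnd B → A ≥G B → A ≽ B
≥G⇒≽ {A} {B} dA dB A≥B = decidable-stable (≽-dec A B) λ A⋡B →
  let X , A⊕X-rightWins , B⊕X-¬rightWins = ¬≽⇒separatingGame dA dB A⋡B
  in B⊕X-¬rightWins (≤ₒ-rightWins (A≥B X) A⊕X-rightWins)

≡G⇒≋ : ∀ {A B} → DeadEnd A → DeadEnd B → A ≡G B → A ≋ B
≡G⇒≋ dA dB (A≥B , B≥A) = ≥G⇒≽ dA dB A≥B , ≥G⇒≽ dB dA B≥A

≋⇒≡G : ∀ {A B} → DeadEnd A → DeadEnd B → A ≋ B → A ≡G B
≋⇒≡G dA dB (A≽B , B≽A) = ≽⇒≥G dA dB A≽B , ≽⇒≥G dB dA B≽A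

IsLeastRightOpt : (Y : Game) → Fin (nRight Y) → Set
IsLeastRightOpt Y m = ∀ n → rightOpt Y n ≽ rightOpt Y m

oneBar⊕≋⇒leastRightOpt : ∀ {G Y} → oneBar ⊕ G ≋ Y → ∃ (IsLeastRightOpt Y)
oneBar⊕≋⇒leastRightOpt {G} {Y} (oneBar⊕G≽Y , Y≽oneBar⊕G) =
  let m , G≽Yₘ = oneBar⊕-≽⇒≽R oneBar⊕G≽Y in m , λ n →
    let p , Yₙ≽ = rightOpt-≽ Y≽oneBar⊕G n in
    ≽-trans Yₙ≽ (≽-trans (rightOpt-oneBar⊕-≽ G p) G≽Yₘ)

leastRightOpt-⊕ : ∀ A B {m} → IsLeastRightOpt (A ⊕ B) m →
  ∃ (IsLeastRightOpt A) ⊎ ∃ (IsLeastRightOpt B)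
leastRightOpt-⊕ A B {m} least = Sum.map
  (λ (s , eqₘ) → s , λ r → let k , eqₖ = rightOpt-⊕ˡ A B r in
    ≽-cancelʳ B (subst₂ _≽_ eqₖ eqₘ (least k)))
  (λ (t , eqₘ) → t , λ r → let k , eqₖ = rightOpt-⊕ʳ A B r in
    ≽-cancelˡ A (subst₂ _≽_ eqₖ eqₘ (least k)))
  (rightOpt-⊕ A B m)

leastRightOpt⇒≋oneBar⊕ : ∀ Y {r} → IsLeastRightOpt Y r → Y ≋ oneBar ⊕ rightOpt Y r
leastRightOpt⇒≋oneBar⊕ Y {r} least =
  ≽-intro (λ noY → ⊥-elim (¬Fin0 (subst Fin noY r))) (≽⇒≽R-oneBar⊕ ∘ least) ,
  ≽-intro (⊥-elim ∘ oneBar⊕-¬NoRight X) (λ p → r , rightOpt-oneBar⊕-≽ X p)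
  where X = rightOpt Y r

leastRightOpt⇒oneBar-divides : ∀ {Y} → DeadEnd Y → ∃ (IsLeastRightOpt Y) →
  Σ Game λ X → LeftDeadEnd X × Y ≡G (oneBar ⊕ X)
leastRightOpt⇒oneBar-divides {Y} dY (r , least) =
  rightOpt Y r , DeadEnd⇒LeftDeadEnd dX ,
  ≋⇒≡G dY (DeadEnd-⊕ oneBar-DeadEnd dX) (leastRightOpt⇒≋oneBar⊕ Y least)
  where dX = DeadEnd-rightOpt dY r

mainTheorem8 : (H K : Game) → LeftDeadEnd H → LeftDeadEnd K →
    Σ Game (λ G → LeftDeadEnd G × ((oneBar ⊕ G) ≡G (H ⊕ K))) →
    Σ Game (λ X → LeftDeadEnd X × ((H ≡G (oneBar ⊕ X)) ⊎ (K ≡G (oneBar ⊕ X))))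
mainTheorem8 H K ldH ldK (G , ldG , oneBar⊕G≡H⊕K) =
  case leastRightOpt-⊕ H K (proj₂ (oneBar⊕≋⇒leastRightOpt oneBar⊕G≋H⊕K)) of λ where
    (inj₁ leastH) → Product.map₂ (Product.map₂ inj₁) (leastRightOpt⇒oneBar-divides dH leastH)
    (inj₂ leastK) → Product.map₂ (Product.map₂ inj₂) (leastRightOpt⇒oneBar-divides dK leastK)
  where
  dH = LeftDeadEnd⇒DeadEnd H ldH
  dK = LeftDeadEnd⇒DeadEnd K ldK
  oneBar⊕G≋H⊕K : oneBar ⊕ G ≋ H ⊕ K
  oneBar⊕G≋H⊕K = ≡G⇒≋ (DeadEnd-⊕ oneBar-DeadEnd (LeftDeadEnd⇒DeadEnd G ldG)) (DeadEnd-⊕ dH dK)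
                      oneBar⊕G≡H⊕K
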